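{- Let $n\geqslant2$ and $(u_1,\dots,u_n)\in(\overline{K_0}^*)^{n}$, and let $\mathcal{V}=\Theta(u_1,\dots,u_n)$ be the associated $n$-flag in $\overline{K_0}$. Then $\mathcal{V}$ is a $\Phi_T$-torsion $n$-flag if and only if $$G=\frac{u_1^{q^2+q+1}-1}{u_1^{q+1}}\quad\text{and}\quad \kappa^{(u_1)}(u_2)=\kappa^{(u_2)}(u_3)=\cdots=\kappa^{(u_{n-1})}(u_n)=0.$$
   Context: $q$ is a prime power, $K_0=\mathbb{F}_q(G)$ with $G$ an indeterminate, and $\overline{K_0}$ an algebraic closure. $\overline{K_0}\{\tau\}$ is the twisted polynomial ring ($\tau a=a^q\tau$), acting on $\overline{K_0}$ by $\sum g_i\tau^i(\mu)=\sum g_i\mu^{q^i}$. $\Phi_T=-\tau^3+G\tau^2+1$. An $n$-flag in $\overline{K_0}$ is a chain $V_1\subset\cdots\subset V_n$ of $\mathbb{F}_q$-subspaces with $\dim V_i=i$; it is a $\Phi_T$-torsion $n$-flag if $\Phi_T(V_1)=0$ and $\Phi_T(V_i)\subseteq V_{i-1}$ for $2\le i\le n$. For $u\in\overline{K_0}^*$ let $\lambda^{(u)}=\tau-u$, and $\Theta(u_1,\dots,u_n)$ is the flag with $V_i=\mathrm{Ker}(\lambda^{(u_i)}\cdots\lambda^{(u_1)})$. The modular polynomial is $\kappa^{(u)}(X)=X^{q^2+q+1}+\frac{1-u^{q^2+q+1}}{u^{q^2+q}}X^{q+1}-1$. -}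

module Defs where

open import Level using (Level; _⊔_) renaming (suc to lsuc)
open import Data.Nat using (ℕ; zero; suc; _≤_; _<_; _^_)
open import Data.Nat.Primality using (Prime)
open import Data.Product using (Σ; ∃; _×_; _,_)
open import Data.List using (List; []; _∷_; _++_; [_])
open import Data.List.Relation.Unary.All using (All)
open import Data.List.Relation.Unary.Any using (Any)
open import Relation.Nullary using (¬_)
open import Relation.Binary.PropositionalEquality using (_≡_)
open import Algebra.Bundles using (CommutativeRing)

IsPrimePower : ℕ → Set
IsPrimePower q = Σ ℕ λ p → Σ ℕ λ e → Prime p × 1 ≤ e × q ≡ p ^ e

module RingOps {c ℓ : Level} (R : CommutativeRing c ℓ) (q : ℕ) where
  open CommutativeRing R

  -- powers and polynomial evaluation (coefficients from low to high degree)
  pow : Carrier → ℕ → Carrier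
  pow x zero = 1#
  pow x (suc n) = x * pow x n

  evalPoly : List Carrier → Carrier → Carrier
  evalPoly [] x = 0#
  evalPoly (a ∷ as) x = a + x * evalPoly as x

  natR : ℕ → Carrier
  natR zero = 0#
  natR (suc n) = 1# + natR n

  InFq : Carrier → Set ℓ
  InFq a = pow a q ≈ a

  InFqG : Carrier → Carrier → Set (c ⊔ ℓ)
  InFqG G b = ∃ λ (ds : List Carrier) → All InFq ds × evalPoly ds G ≈ b

-- An algebraic closure of K₀ = 𝔽_q(G), G an indeterminate.
-- Modelled as: a field L (commutative ring + inverses of nonzero elements),
-- of characteristic p where q = p^e (p prime, e ≥ 1), algebraically closed,
-- with an element G transcendental over 𝔽_q = { a ∈ L | a^q = a }, and such
-- that every element of L is algebraic over 𝔽_q(G) (equivalently, clearing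
-- denominators, over 𝔽_q[G]).
record AlgClosureFqG (c ℓ : Level) (q : ℕ) : Set (lsuc (c ⊔ ℓ)) where
  field
    L-ring : CommutativeRing c ℓ
  open CommutativeRing L-ring public
  open RingOps L-ring q public
  field
    _⁻¹        : Carrier → Carrier
    0≉1        : ¬ (0# ≈ 1#)
    inverseʳ   : ∀ x → ¬ (x ≈ 0#) → x * (x ⁻¹) ≈ 1#
    p          : ℕ
    e          : ℕ
    p-prime    : Prime p
    1≤e        : 1 ≤ e
    q≡pᵉ       : q ≡ p ^ e
    char-p     : natR p ≈ 0#
    -- every monic polynomial of degree ≥ 1 has a root
    algClosed  : ∀ (as : List Carrier) → ¬ (as ≡ []) →
                 ∃ λ x → evalPoly (as ++ [ 1# ]) x ≈ 0#
    G          : Carrier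
    G-transc   : ∀ (as : List Carrier) → All InFq as →
                 evalPoly as G ≈ 0# → All (λ a → a ≈ 0#) as
    algebraic  : ∀ x → ∃ λ (cs : List Carrier) →
                 All (InFqG G) cs × Any (λ b → ¬ (b ≈ 0#)) cs × evalPoly cs x ≈ 0#

module Ops {c ℓ : Level} {q : ℕ} (L : AlgClosureFqG c ℓ q) where
  open AlgClosureFqG L public

  _/_ : Carrier → Carrier → Carrier
  x / y = x * (y ⁻¹)

  τ^ : ℕ → Carrier → Carrier
  τ^ i μ = pow μ (q ^ i)

  Φ_T : Carrier → Carrier
  Φ_T μ = (- τ^ 3 μ) + (G * τ^ 2 μ) + μ

  lam : Carrier → Carrier → Carrier
  lam u μ = τ^ 1 μ - (u * μ)

  lams : (ℕ → Carrier) → ℕ → Carrier → Carrier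
  lams u zero μ = μ
  lams u (suc i) μ = lam (u (suc i)) (lams u i μ)

  -- V_i = Ker(λ^(u_i) ⋯ λ^(u_1)), the i-th space of Θ(u_1,…,u_n)
  V : (ℕ → Carrier) → ℕ → Carrier → Set ℓ
  V u i μ = lams u i μ ≈ 0#

  IsΦTorsionFlag : ℕ → (ℕ → Carrier) → Set (c ⊔ ℓ)
  IsΦTorsionFlag n u =
    (∀ μ → V u 1 μ → Φ_T μ ≈ 0#) ×
    (∀ i → 2 ≤ i → i ≤ n → ∀ μ → V u i μ → V u (Data.Nat.pred i) (Φ_T μ))

  κ : Carrier → Carrier → Carrier
  κ u X = pow X (q ^ 2 Data.Nat.+ q Data.Nat.+ 1)
          + ((1# - pow u (q ^ 2 Data.Nat.+ q Data.Nat.+ 1)) / pow u (q ^ 2 Data.Nat.+ q))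
            * pow X (q Data.Nat.+ 1)
          - 1#

-- Write F for the q-th power map, a ring endomorphism of L because L has characteristic p, so that
-- λ^(u) = F - u and Φ_H = -F³ + H F² + 1 with Φ_G = Φ_T. A direct computation shows that
-- λ^(u) Φ_H = Φ_H' λ^(u) for an explicit H' = G⁺(u) whenever u is a root of
-- P_H(X) = -X^(q²+q+1) + H X^(q+1) + 1, and that Φ_H acts on every x with F x = u x as
-- multiplication by P_H(u). Hence, with G_0 = G and G_k = G⁺(u_k), as long as P_(G_(j-1))(u_j) = 0
-- for all j ≤ k we get λ^(u_k)⋯λ^(u_1) Φ_T = Φ_(G_k) λ^(u_k)⋯λ^(u_1). Since V_(k+1) is mapped by
-- λ^(u_k)⋯λ^(u_1) onto Ker λ^(u_(k+1)), whose nonzero elements exist (L is algebraically closed) and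
-- are F-eigenvectors with eigenvalue u_(k+1), the step Φ_T(V_(k+1)) ⊆ V_k holds iff
-- P_(G_k)(u_(k+1)) = 0. Finally P_G(u_1) = 0 is the stated formula for G, and
-- κ^(u_k)(u_(k+1)) = -P_(G_k)(u_(k+1)).

module Submission where

open import Defs
open import Level using (Level)
open import Data.Nat using (ℕ; zero; suc; _≤_; _<_; _^_; z≤n; s≤s) renaming (_+_ to _+ℕ_)
import Data.Nat as ℕ
import Data.Nat.Properties as ℕₚ
open import Data.Integer as ℤ using (ℤ; +_; -[1+_]; _⊖_)
import Data.Integer.Properties as ℤₚ
open import Data.Sign as Sign using (Sign)
open import Data.Maybe using (Maybe; just; nothing)
open import Data.Product using (∃; _×_; _,_; uncurry)
open import Data.Sum using (inj₁; inj₂)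
open import Relation.Nullary using (¬_; yes; no)
open import Relation.Binary.PropositionalEquality as ≡ using (_≡_)
open import Function.Bundles using (_⇔_; mk⇔; module Equivalence)
open import Function.Construct.Composition using (_⇔-∘_)
open import Algebra.Bundles using (CommutativeRing)
import Algebra.Solver.Ring.AlmostCommutativeRing as ACR
open import Algebra.Morphism.Structures using (IsRingHomomorphism; module IsRingHomomorphism)

-- Ring normalisation with integer coefficients in an arbitrary commutative ring: the solver
-- needs the canonical map ℤ → R as a homomorphism so that coefficients such as 1 - 1 cancel.
module IntegerCoefficientSolver {c ℓ : Level} (R : CommutativeRing c ℓ) where
  open CommutativeRing R
  open import Algebra.Properties.Semiring.Mult.TCOptimised semiring using (1+×; ×-homo-+; ×1-homo-*) renaming (_×_ to _×ᴿ_)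
  open import Algebra.Properties.Ring ring using (-‿distribˡ-*; -‿involutive; -0#≈0#)
  open import Algebra.Properties.AbelianGroup +-abelianGroup using (⁻¹-∙-comm)
  open import Relation.Binary.Reasoning.Setoid setoid

  ⟦_⟧ℕ : ℕ → Carrier
  ⟦ n ⟧ℕ = n ×ᴿ 1#

  ⟦_⟧ℤ : ℤ → Carrier
  ⟦ + n ⟧ℤ = ⟦ n ⟧ℕ
  ⟦ -[1+ n ] ⟧ℤ = - ⟦ suc n ⟧ℕ

  ⟦_⟧ˢ : Sign → Carrier
  ⟦ Sign.+ ⟧ˢ = 1#
  ⟦ Sign.- ⟧ˢ = - 1#

  ⊖-homo : ∀ m n → ⟦ m ⊖ n ⟧ℤ ≈ ⟦ m ⟧ℕ - ⟦ n ⟧ℕ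
  ⊖-homo zero zero = sym (trans (+-congˡ -0#≈0#) (+-identityʳ _))
  ⊖-homo zero (suc n) = sym (+-identityˡ _)
  ⊖-homo (suc m) zero = sym (trans (+-congˡ -0#≈0#) (+-identityʳ _))
  ⊖-homo (suc m) (suc n) = begin
    ⟦ suc m ⊖ suc n ⟧ℤ             ≡⟨ ≡.cong ⟦_⟧ℤ (ℤₚ.[1+m]⊖[1+n]≡m⊖n m n) ⟩
    ⟦ m ⊖ n ⟧ℤ                     ≈⟨ ⊖-homo m n ⟩
    ⟦ m ⟧ℕ - ⟦ n ⟧ℕ                ≈⟨ +-identityˡ _ ⟨
    0# + (⟦ m ⟧ℕ - ⟦ n ⟧ℕ)         ≈⟨ +-congʳ (-‿inverseʳ 1#) ⟨
    (1# - 1#) + (⟦ m ⟧ℕ - ⟦ n ⟧ℕ)  ≈⟨ +-assoc _ _ _ ⟩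
    1# + (- 1# + (⟦ m ⟧ℕ - ⟦ n ⟧ℕ)) ≈⟨ +-congˡ (trans (sym (+-assoc _ _ _)) (trans (+-congʳ (+-comm _ _)) (+-assoc _ _ _))) ⟩
    1# + (⟦ m ⟧ℕ + (- 1# - ⟦ n ⟧ℕ)) ≈⟨ +-assoc _ _ _ ⟨
    (1# + ⟦ m ⟧ℕ) + (- 1# - ⟦ n ⟧ℕ) ≈⟨ +-congˡ (⁻¹-∙-comm _ _) ⟩
    (1# + ⟦ m ⟧ℕ) - (1# + ⟦ n ⟧ℕ)   ≈⟨ +-cong (1+× m 1#) (-‿cong (1+× n 1#)) ⟨
    ⟦ suc m ⟧ℕ - ⟦ suc n ⟧ℕ        ∎

  +-homo : ∀ i j → ⟦ i ℤ.+ j ⟧ℤ ≈ ⟦ i ⟧ℤ + ⟦ j ⟧ℤ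
  +-homo (+ m) (+ n) = ×-homo-+ 1# m n
  +-homo (+ m) -[1+ n ] = ⊖-homo m (suc n)
  +-homo -[1+ m ] (+ n) = trans (⊖-homo n (suc m)) (+-comm _ _)
  +-homo -[1+ m ] -[1+ n ] = begin
    - ⟦ suc (suc (m +ℕ n)) ⟧ℕ     ≡⟨ ≡.cong (λ k → - ⟦ k ⟧ℕ) (ℕₚ.+-suc (suc m) n) ⟨
    - ⟦ suc m +ℕ suc n ⟧ℕ          ≈⟨ -‿cong (×-homo-+ 1# (suc m) (suc n)) ⟩
    - (⟦ suc m ⟧ℕ + ⟦ suc n ⟧ℕ)    ≈⟨ ⁻¹-∙-comm _ _ ⟨
    - ⟦ suc m ⟧ℕ - ⟦ suc n ⟧ℕ      ∎

  ◃-homo : ∀ s n → ⟦ s ℤ.◃ n ⟧ℤ ≈ ⟦ s ⟧ˢ * ⟦ n ⟧ℕ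
  ◃-homo s zero = sym (zeroʳ _)
  ◃-homo Sign.+ (suc n) = sym (*-identityˡ _)
  ◃-homo Sign.- (suc n) = trans (-‿cong (sym (*-identityˡ _))) (-‿distribˡ-* _ _)

  ◃-sign-abs : ∀ i → ⟦ i ⟧ℤ ≈ ⟦ ℤ.sign i ⟧ˢ * ⟦ ℤ.∣ i ∣ ⟧ℕ
  ◃-sign-abs i = trans (reflexive (≡.cong ⟦_⟧ℤ (≡.sym (ℤₚ.◃-inverse i)))) (◃-homo (ℤ.sign i) ℤ.∣ i ∣)

  *-homoˢ : ∀ s t → ⟦ s Sign.* t ⟧ˢ ≈ ⟦ s ⟧ˢ * ⟦ t ⟧ˢ
  *-homoˢ Sign.+ t = sym (*-identityˡ _)
  *-homoˢ Sign.- Sign.+ = sym (*-identityʳ _)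
  *-homoˢ Sign.- Sign.- = sym (trans (sym (-‿distribˡ-* _ _)) (trans (-‿cong (*-identityˡ _)) (-‿involutive _)))

  *-homo : ∀ i j → ⟦ i ℤ.* j ⟧ℤ ≈ ⟦ i ⟧ℤ * ⟦ j ⟧ℤ
  *-homo i j = begin
    ⟦ s Sign.* t ℤ.◃ ∣i∣ ℕ.* ∣j∣ ⟧ℤ          ≈⟨ ◃-homo (s Sign.* t) (∣i∣ ℕ.* ∣j∣) ⟩
    ⟦ s Sign.* t ⟧ˢ * ⟦ ∣i∣ ℕ.* ∣j∣ ⟧ℕ       ≈⟨ *-cong (*-homoˢ s t) (×1-homo-* ∣i∣ ∣j∣) ⟩
    (⟦ s ⟧ˢ * ⟦ t ⟧ˢ) * (⟦ ∣i∣ ⟧ℕ * ⟦ ∣j∣ ⟧ℕ) ≈⟨ *-assoc _ _ _ ⟩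
    ⟦ s ⟧ˢ * (⟦ t ⟧ˢ * (⟦ ∣i∣ ⟧ℕ * ⟦ ∣j∣ ⟧ℕ)) ≈⟨ *-congˡ (trans (sym (*-assoc _ _ _)) (trans (*-congʳ (*-comm _ _)) (*-assoc _ _ _))) ⟩
    ⟦ s ⟧ˢ * (⟦ ∣i∣ ⟧ℕ * (⟦ t ⟧ˢ * ⟦ ∣j∣ ⟧ℕ)) ≈⟨ *-assoc _ _ _ ⟨
    (⟦ s ⟧ˢ * ⟦ ∣i∣ ⟧ℕ) * (⟦ t ⟧ˢ * ⟦ ∣j∣ ⟧ℕ) ≈⟨ *-cong (◃-sign-abs i) (◃-sign-abs j) ⟨
    ⟦ i ⟧ℤ * ⟦ j ⟧ℤ                          ∎
    where s = ℤ.sign i; t = ℤ.sign j; ∣i∣ = ℤ.∣ i ∣; ∣j∣ = ℤ.∣ j ∣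

  -‿homo : ∀ i → ⟦ ℤ.- i ⟧ℤ ≈ - ⟦ i ⟧ℤ
  -‿homo (+ zero) = sym -0#≈0#
  -‿homo (+ suc n) = refl
  -‿homo -[1+ n ] = sym (-‿involutive _)

  ℤ⟶R : ℤ.+-*-rawRing ACR.-Raw-AlmostCommutative⟶ ACR.fromCommutativeRing R
  ℤ⟶R = record
    { ⟦_⟧ = ⟦_⟧ℤ ; +-homo = +-homo ; *-homo = *-homo ; -‿homo = -‿homo
    ; 0-homo = refl ; 1-homo = refl }

  ⟦⟧ℤ-≟ : ∀ i j → Maybe (⟦ i ⟧ℤ ≈ ⟦ j ⟧ℤ)
  ⟦⟧ℤ-≟ i j with i ℤ.≟ j
  ... | yes ≡.refl = just refl
  ... | no _ = nothing

  open import Algebra.Solver.Ring ℤ.+-*-rawRing (ACR.fromCommutativeRing R) ℤ⟶R ⟦⟧ℤ-≟ public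

module BinomialCoefficients where
  open import Data.Nat using (_+_; _*_)
  open import Data.Nat.Combinatorics using (_C_; nCk+nC[k+1]≡[n+1]C[k+1]; nC1≡n)
  open import Data.Nat.Divisibility using (_∣_; divides; ∣⇒≤)
  open import Data.Nat.Primality using (Prime; euclidsLemma)
  open import Data.Nat.Solver using (module +-*-Solver)
  open +-*-Solver using (solve; _:+_; _:*_; _:=_; con)
  open import Data.Empty using (⊥-elim)
  open ≡.≡-Reasoning

  [k+1]*[n+1]C[k+1]≡[n+1]*nCk : ∀ n k → suc k * (suc n C suc k) ≡ suc n * (n C k)
  [k+1]*[n+1]C[k+1]≡[n+1]*nCk zero zero = ≡.refl
  [k+1]*[n+1]C[k+1]≡[n+1]*nCk zero (suc k) = ℕₚ.*-zeroʳ (suc (suc k))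
  [k+1]*[n+1]C[k+1]≡[n+1]*nCk (suc n) zero =
    ≡.trans (ℕₚ.+-identityʳ _) (≡.trans (nC1≡n (suc (suc n))) (≡.sym (ℕₚ.*-identityʳ _)))
  [k+1]*[n+1]C[k+1]≡[n+1]*nCk (suc n) (suc k) = begin
    suc (suc k) * (suc (suc n) C suc (suc k)) ≡⟨ ≡.cong (suc (suc k) *_) (nCk+nC[k+1]≡[n+1]C[k+1] (suc n) (suc k)) ⟨
    suc (suc k) * (A + B)                     ≡⟨ solve 3 (λ k a b → (con 2 :+ k) :* (a :+ b) := a :+ (con 1 :+ k) :* a :+ (con 2 :+ k) :* b) ≡.refl k A B ⟩
    A + suc k * A + suc (suc k) * B           ≡⟨ ≡.cong₂ (λ x y → A + x + y) ([k+1]*[n+1]C[k+1]≡[n+1]*nCk n k) ([k+1]*[n+1]C[k+1]≡[n+1]*nCk n (suc k)) ⟩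
    A + suc n * X + suc n * Y                 ≡⟨ solve 4 (λ n a x y → a :+ (con 1 :+ n) :* x :+ (con 1 :+ n) :* y := a :+ (con 1 :+ n) :* (x :+ y)) ≡.refl n A X Y ⟩
    A + suc n * (X + Y)                       ≡⟨ ≡.cong (λ x → A + suc n * x) (nCk+nC[k+1]≡[n+1]C[k+1] n k) ⟩
    A + suc n * A                             ∎
    where
    A B X Y : ℕ
    A = suc n C suc k
    B = suc n C suc (suc k)
    X = n C k
    Y = n C suc k

  prime∣pCk : ∀ {n k} → Prime (suc n) → suc k < suc n → suc n ∣ suc n C suc k
  prime∣pCk {n} {k} p-prime k<p
    with euclidsLemma (suc k) (suc n C suc k) p-prime
           (divides (n C k) (≡.trans ([k+1]*[n+1]C[k+1]≡[n+1]*nCk n k) (ℕₚ.*-comm (suc n) (n C k))))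
  ... | inj₁ p∣k+1 = ⊥-elim (ℕₚ.<⇒≱ k<p (∣⇒≤ p∣k+1))
  ... | inj₂ p∣pCk = p∣pCk

module Frobenius {c ℓ : Level} (R : CommutativeRing c ℓ) (q : ℕ) where
  open CommutativeRing R
  open RingOps R q using (pow; natR)
  open import Algebra.Properties.Semiring.Exp semiring using (^-congˡ; ^-homo-*; ^-assocʳ) renaming (_^_ to _^ᴿ_)
  open import Algebra.Properties.CommutativeSemiring.Exp commutativeSemiring using (^-distrib-*)
  open import Algebra.Properties.Semiring.Mult semiring using (×-congʳ; ×-assocˡ; ×-assoc-*) renaming (_×_ to _×ᴿ_)
  open import Algebra.Properties.Monoid.Sum +-monoid using (sum; sum-init-last; sum-cong-≋; sum-replicate-zero)
  import Algebra.Properties.CommutativeSemiring.Binomial commutativeSemiring as Binomial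
  open import Algebra.Properties.Ring ring using (x+x≈x⇒x≈0)
  open import Algebra.Properties.Group +-group using (inverseˡ-unique)
  open import Data.Nat.Combinatorics using (_C_; nCn≡1)
  open import Data.Nat.Divisibility using (_∣_; divides)
  open import Data.Nat.Primality using (Prime)
  open BinomialCoefficients using (prime∣pCk)
  open import Data.Fin as Fin using (Fin; toℕ; inject₁; fromℕ)
  import Data.Fin.Properties as Finₚ
  open import Data.Vec.Functional using (Vector; tail; init; last; replicate)
  open import Relation.Binary.Reasoning.Setoid setoid

  pow≈^ : ∀ x n → pow x n ≈ x ^ᴿ n
  pow≈^ x zero = refl
  pow≈^ x (suc n) = *-congˡ (pow≈^ x n)

  pow-cong : ∀ n {x y} → x ≈ y → pow x n ≈ pow y n
  pow-cong zero _ = refl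
  pow-cong (suc n) x≈y = *-cong x≈y (pow-cong n x≈y)

  pow-congʳ : ∀ x {m n} → m ≡ n → pow x m ≈ pow x n
  pow-congʳ x ≡.refl = refl

  pow-homo-* : ∀ x m n → pow x (m +ℕ n) ≈ pow x m * pow x n
  pow-homo-* x m n = trans (pow≈^ x (m +ℕ n)) (trans (^-homo-* x m n) (sym (*-cong (pow≈^ x m) (pow≈^ x n))))

  pow-assocʳ : ∀ x m n → pow (pow x m) n ≈ pow x (m ℕ.* n)
  pow-assocʳ x m n = trans (pow≈^ _ n) (trans (^-congˡ n (pow≈^ x m)) (trans (^-assocʳ x m n) (sym (pow≈^ x (m ℕ.* n)))))

  pow-distrib-* : ∀ x y n → pow (x * y) n ≈ pow x n * pow y n
  pow-distrib-* x y n = trans (pow≈^ _ n) (trans (^-distrib-* x y n) (sym (*-cong (pow≈^ x n) (pow≈^ y n))))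

  pow-1# : ∀ n → pow 1# n ≈ 1#
  pow-1# zero = refl
  pow-1# (suc n) = trans (*-identityˡ _) (pow-1# n)

  natR≈×1# : ∀ n → natR n ≈ n ×ᴿ 1#
  natR≈×1# zero = refl
  natR≈×1# (suc n) = +-congˡ (natR≈×1# n)

  ∣⇒×≈0# : ∀ {p m} → natR p ≈ 0# → ∀ x → p ∣ m → m ×ᴿ x ≈ 0#
  ∣⇒×≈0# {p} char-p x (divides d ≡.refl) = begin
    (d ℕ.* p) ×ᴿ x        ≡⟨ ≡.cong (_×ᴿ x) (ℕₚ.*-comm d p) ⟩
    (p ℕ.* d) ×ᴿ x        ≈⟨ ×-assocˡ x p d ⟨
    p ×ᴿ (d ×ᴿ x)         ≈⟨ ×-congʳ p (*-identityˡ _) ⟨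
    p ×ᴿ (1# * d ×ᴿ x)    ≈⟨ ×-assoc-* p 1# _ ⟨
    (p ×ᴿ 1#) * d ×ᴿ x    ≈⟨ *-congʳ (trans (sym (natR≈×1# p)) char-p) ⟩
    0# * d ×ᴿ x           ≈⟨ zeroˡ _ ⟩
    0#                    ∎

  -- In characteristic p every binomial coefficient p C k with 0 < k < p vanishes.
  pow-p-homo-+ : ∀ {p} → Prime p → natR p ≈ 0# → ∀ x y → pow (x + y) p ≈ pow x p + pow y p
  pow-p-homo-+ {zero} ()
  pow-p-homo-+ {suc n} p-prime char-p x y = begin
    pow (x + y) (suc n)                                ≈⟨ pow≈^ _ (suc n) ⟩
    (x + y) ^ᴿ suc n                                   ≈⟨ Binomial.theorem (suc n) x y ⟩
    t Fin.zero + sum (tail t)                          ≈⟨ +-congˡ (sum-init-last (tail t)) ⟩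
    t Fin.zero + (sum (init (tail t)) + last (tail t)) ≈⟨ +-cong first (+-cong middle lastTerm) ⟩
    pow y (suc n) + (0# + pow x (suc n))               ≈⟨ trans (+-congˡ (+-identityˡ _)) (+-comm _ _) ⟩
    pow x (suc n) + pow y (suc n)                      ∎
    where
    t : Vector Carrier (suc (suc n))
    t = Binomial.binomialTerm x y (suc n)
    first : t Fin.zero ≈ pow y (suc n)
    first = trans (+-identityʳ _) (trans (*-identityˡ _) (sym (pow≈^ y (suc n))))
    k<n : ∀ (i : Fin n) → suc (toℕ (inject₁ i)) < suc n
    k<n i = s≤s (≡.subst (_< n) (≡.sym (Finₚ.toℕ-inject₁ i)) (Finₚ.toℕ<n i))
    middle : sum (init (tail t)) ≈ 0#
    middle = trans (sum-cong-≋ {x = init (tail t)} {replicate n 0#} λ i → ∣⇒×≈0# char-p _ (prime∣pCk p-prime (k<n i)))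
                   (sum-replicate-zero n)
    top : ∀ k → k ≡ n → (suc n C suc k) ×ᴿ (x ^ᴿ suc k * y ^ᴿ (n ℕ.∸ k)) ≈ pow x (suc n)
    top k ≡.refl rewrite nCn≡1 (suc k) | ℕₚ.n∸n≡0 k = trans (+-identityʳ _) (trans (*-identityʳ _) (sym (pow≈^ x (suc k))))
    lastTerm : last (tail t) ≈ pow x (suc n)
    lastTerm = top (toℕ (fromℕ n)) (Finₚ.toℕ-fromℕ n)

  module _ {p e : ℕ} (p-prime : Prime p) (q≡pᵉ : q ≡ p ^ e) (char-p : natR p ≈ 0#) where

    pow-pᵏ-homo-+ : ∀ k x y → pow (x + y) (p ^ k) ≈ pow x (p ^ k) + pow y (p ^ k)
    pow-pᵏ-homo-+ zero x y = trans (*-identityʳ _) (sym (+-cong (*-identityʳ _) (*-identityʳ _)))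
    pow-pᵏ-homo-+ (suc k) x y = begin
      pow (x + y) (p ℕ.* p ^ k)                         ≈⟨ pow-assocʳ (x + y) p (p ^ k) ⟨
      pow (pow (x + y) p) (p ^ k)                       ≈⟨ pow-cong (p ^ k) (pow-p-homo-+ p-prime char-p x y) ⟩
      pow (pow x p + pow y p) (p ^ k)                   ≈⟨ pow-pᵏ-homo-+ k (pow x p) (pow y p) ⟩
      pow (pow x p) (p ^ k) + pow (pow y p) (p ^ k)     ≈⟨ +-cong (pow-assocʳ x p (p ^ k)) (pow-assocʳ y p (p ^ k)) ⟩
      pow x (p ℕ.* p ^ k) + pow y (p ℕ.* p ^ k)         ∎

    pow-q-homo-+ : ∀ x y → pow (x + y) q ≈ pow x q + pow y q
    pow-q-homo-+ x y = ≡.subst (λ m → pow (x + y) m ≈ pow x m + pow y m) (≡.sym q≡pᵉ) (pow-pᵏ-homo-+ e x y)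

    pow-q-homo-0# : pow 0# q ≈ 0#
    pow-q-homo-0# = x+x≈x⇒x≈0 _ (trans (sym (pow-q-homo-+ 0# 0#)) (pow-cong q (+-identityʳ 0#)))

    pow-q-homo-neg : ∀ x → pow (- x) q ≈ - pow x q
    pow-q-homo-neg x = inverseˡ-unique _ _ (trans (sym (pow-q-homo-+ (- x) x)) (trans (pow-cong q (-‿inverseˡ x)) pow-q-homo-0#))

    frobenius : IsRingHomomorphism rawRing rawRing (λ x → pow x q)
    frobenius = record
      { isSemiringHomomorphism = record
        { isNearSemiringHomomorphism = record
          { +-isMonoidHomomorphism = record
            { isMagmaHomomorphism = record
              { isRelHomomorphism = record { cong = pow-cong q }
              ; homo = pow-q-homo-+ }
            ; ε-homo = pow-q-homo-0# }
          ; *-homo = λ x y → pow-distrib-* x y q }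
        ; 1#-homo = pow-1# q }
      ; -‿homo = pow-q-homo-neg }

module TwistedOperators {r ℓ : Level} (R : CommutativeRing r ℓ)
  (F : CommutativeRing.Carrier R → CommutativeRing.Carrier R)
  (F-isRingHom : IsRingHomomorphism (CommutativeRing.rawRing R) (CommutativeRing.rawRing R) F) where
  open CommutativeRing R
  open IsRingHomomorphism F-isRingHom
    renaming (⟦⟧-cong to F-cong; +-homo to F-+; *-homo to F-*; -‿homo to F-neg; 0#-homo to F-0#; 1#-homo to F-1#)
  open IntegerCoefficientSolver R using (solve; _:+_; _:*_; _:-_; :-_; _:=_; con)
  open import Algebra.Properties.Group +-group using (x≈y⇒x∙y⁻¹≈ε)
  open import Relation.Binary.Reasoning.Setoid setoid

  -- F stands for τ, so λ[ u ] is λ^(u) and Φ[ H ] is -τ³ + H τ² + 1.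
  λ[_] : Carrier → Carrier → Carrier
  λ[ u ] μ = F μ - u * μ

  Φ[_] : Carrier → Carrier → Carrier
  Φ[ H ] μ = - F (F (F μ)) + H * F (F μ) + μ

  Φ-eigenvalue : Carrier → Carrier → Carrier
  Φ-eigenvalue H a = - (F (F a) * F a * a) + H * (F a * a) + 1#

  λ-congʳ : ∀ u {x y} → x ≈ y → λ[ u ] x ≈ λ[ u ] y
  λ-congʳ u x≈y = +-cong (F-cong x≈y) (-‿cong (*-congˡ x≈y))

  Φ-congʳ : ∀ H {x y} → x ≈ y → Φ[ H ] x ≈ Φ[ H ] y
  Φ-congʳ H x≈y = +-cong (+-cong (-‿cong (F-cong (F-cong (F-cong x≈y)))) (*-congˡ (F-cong (F-cong x≈y)))) x≈y

  F-λ : ∀ u μ → F (λ[ u ] μ) ≈ λ[ F u ] (F μ)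
  F-λ u μ = trans (F-+ _ _) (+-congˡ (trans (F-neg _) (-‿cong (F-* u μ))))

  F-Φ : ∀ H μ → F (Φ[ H ] μ) ≈ - F (F (F (F μ))) + F H * F (F (F μ)) + F μ
  F-Φ H μ = trans (F-+ _ _) (+-congʳ (trans (F-+ _ _) (+-cong (F-neg _) (F-* _ _))))

  Φ-eigenvector : ∀ H a x → F x ≈ a * x → Φ[ H ] x ≈ x * Φ-eigenvalue H a
  Φ-eigenvector H a x Fx≈ax = begin
    - F (F (F x)) + H * F (F x) + x                        ≈⟨ +-congʳ (+-cong (-‿cong F³x≈) (*-congˡ F²x≈)) ⟩
    - (F (F a) * (F a * (a * x))) + H * (F a * (a * x)) + x
      ≈⟨ solve 5 (λ c b a H x → :- (c :* (b :* (a :* x))) :+ H :* (b :* (a :* x)) :+ x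
                             := x :* (:- (c :* b :* a) :+ H :* (b :* a) :+ con (+ 1))) refl (F (F a)) (F a) a H x ⟩
    x * Φ-eigenvalue H a                                   ∎
    where
    F²x≈ : F (F x) ≈ F a * (a * x)
    F²x≈ = trans (F-cong Fx≈ax) (trans (F-* a x) (*-congˡ Fx≈ax))
    F³x≈ : F (F (F x)) ≈ F (F a) * (F a * (a * x))
    F³x≈ = trans (F-cong F²x≈) (trans (F-* _ _) (*-congˡ (trans (F-* a x) (*-congˡ Fx≈ax))))

  -- Expanding both sides, they differ by F³μ ((F H + u) - (F³u + H')) - F²μ (u H - H' F²u).
  λ-intertwines-Φ : ∀ u H H' → u * H ≈ H' * F (F u) → F H + u ≈ F (F (F u)) + H' →
                    ∀ μ → λ[ u ] (Φ[ H ] μ) ≈ Φ[ H' ] (λ[ u ] μ)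
  λ-intertwines-Φ u H H' uH≈H'F²u FH+u≈F³u+H' μ = begin
    F (Φ[ H ] μ) - u * Φ[ H ] μ
      ≈⟨ +-congʳ (F-Φ H μ) ⟩
    (- m₄ + F H * m₃ + m₁) - u * (- m₃ + H * m₂ + μ)
      ≈⟨ solve 11 (λ m₁ m₂ m₃ m₄ μ u u₂ u₃ H FH H' →
             (:- m₄ :+ FH :* m₃ :+ m₁) :- u :* (:- m₃ :+ H :* m₂ :+ μ)
          := (:- (m₄ :- u₃ :* m₃) :+ H' :* (m₃ :- u₂ :* m₂) :+ (m₁ :- u :* μ))
             :+ m₃ :* ((FH :+ u) :- (u₃ :+ H')) :- m₂ :* ((u :* H) :- (H' :* u₂)))
          refl m₁ m₂ m₃ m₄ μ u (F (F u)) (F (F (F u))) H (F H) H' ⟩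
    expanded + m₃ * ((F H + u) - (F (F (F u)) + H')) - m₂ * ((u * H) - (H' * F (F u)))
      ≈⟨ +-cong (+-congˡ (*-congˡ (x≈y⇒x∙y⁻¹≈ε FH+u≈F³u+H'))) (-‿cong (*-congˡ (x≈y⇒x∙y⁻¹≈ε uH≈H'F²u))) ⟩
    expanded + m₃ * 0# - m₂ * 0#
      ≈⟨ solve 3 (λ e m₃ m₂ → e :+ m₃ :* con (+ 0) :- m₂ :* con (+ 0) := e) refl expanded m₃ m₂ ⟩
    expanded
      ≈⟨ +-congʳ (+-cong (-‿cong F³λμ≈) (*-congˡ F²λμ≈)) ⟨
    Φ[ H' ] (λ[ u ] μ) ∎
    where
    m₁ m₂ m₃ m₄ expanded : Carrier
    m₁ = F μ
    m₂ = F m₁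
    m₃ = F m₂
    m₄ = F m₃
    expanded = - (m₄ - F (F (F u)) * m₃) + H' * (m₃ - F (F u) * m₂) + (m₁ - u * μ)
    F²λμ≈ : F (F (λ[ u ] μ)) ≈ λ[ F (F u) ] m₂
    F²λμ≈ = trans (F-cong (F-λ u μ)) (F-λ (F u) m₁)
    F³λμ≈ : F (F (F (λ[ u ] μ))) ≈ λ[ F (F (F u)) ] m₃
    F³λμ≈ = trans (F-cong F²λμ≈) (F-λ (F (F u)) m₂)

  F-Φ-eigenvalue : ∀ H a → F (Φ-eigenvalue H a) ≈ Φ-eigenvalue (F H) (F a)
  F-Φ-eigenvalue H a =
    trans (F-+ _ _) (+-cong (trans (F-+ _ _) (+-cong (trans (F-neg _) (-‿cong F³)) (trans (F-* _ _) (*-congˡ (F-* _ _))))) F-1#)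
    where
    F³ : F (F (F a) * F a * a) ≈ F (F (F a)) * F (F a) * F a
    F³ = trans (F-* _ _) (*-congʳ (F-* _ _))

  -- With j the inverse of F² a · F a, this is the coefficient of τ² in the twisted operator Φ[ H' ]
  -- satisfying λ[ a ] ∘ Φ[ H ] = Φ[ H' ] ∘ λ[ a ].
  next-parameter : Carrier → Carrier → Carrier
  next-parameter a j = - ((1# - F (F a) * F a * a) * j)

  intertwining-conditions : ∀ H a j → F (F a) * F a * j ≈ 1# → Φ-eigenvalue H a ≈ 0# →
    (a * H ≈ next-parameter a j * F (F a)) × (F H + a ≈ F (F (F a)) + next-parameter a j)
  intertwining-conditions H a j cbj≈1 eigen≈0 = multiplicative , additive
    where
    b c d : Carrier
    b = F a
    c = F b
    d = F c
    multiplicative : a * H ≈ next-parameter a j * c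
    multiplicative = sym (begin
      - ((1# - c * b * a) * j) * c
        ≈⟨ solve 5 (λ a b c H j → :- ((con (+ 1) :- c :* b :* a) :* j) :* c
              := H :* a :* (c :* b :* j) :- (:- (c :* b :* a) :+ H :* (b :* a) :+ con (+ 1)) :* (j :* c)) refl a b c H j ⟩
      H * a * (c * b * j) - Φ-eigenvalue H a * (j * c) ≈⟨ +-cong (*-congˡ cbj≈1) (-‿cong (*-congʳ eigen≈0)) ⟩
      H * a * 1# - 0# * (j * c)                        ≈⟨ solve 4 (λ a H j c → H :* a :* con (+ 1) :- con (+ 0) :* (j :* c) := a :* H) refl a H j c ⟩
      a * H                                            ∎)
    Feigen≈0 : Φ-eigenvalue (F H) b ≈ 0#
    Feigen≈0 = trans (sym (F-Φ-eigenvalue H a)) (trans (F-cong eigen≈0) F-0#)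
    additive : F H + a ≈ d + next-parameter a j
    additive = begin
      F H + a
        ≈⟨ solve 6 (λ a b c d j FH → FH :+ a :=
                   (d :+ :- ((con (+ 1) :- c :* b :* a) :* j))
                   :+ ((:- (d :* c :* b) :+ FH :* (c :* b) :+ con (+ 1)) :* j
                       :+ (FH :- d :+ a) :* (con (+ 1) :- c :* b :* j))) refl a b c d j (F H) ⟩
      (d + next-parameter a j) + (Φ-eigenvalue (F H) b * j + (F H - d + a) * (1# - c * b * j))
        ≈⟨ +-congˡ (+-cong (*-congʳ Feigen≈0) (*-congˡ (+-congˡ (-‿cong cbj≈1)))) ⟩
      (d + next-parameter a j) + (0# * j + (F H - d + a) * (1# - 1#))
        ≈⟨ solve 3 (λ X j Y → X :+ (con (+ 0) :* j :+ Y :* (con (+ 1) :- con (+ 1))) := X) refl _ j _ ⟩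
      d + next-parameter a j ∎

module TorsionFlags {c ℓ : Level} {q : ℕ} (L : AlgClosureFqG c ℓ q) where
  open Ops L
  open Frobenius L-ring q using (pow-cong; pow-congʳ; pow-homo-*; pow-assocʳ; frobenius)
  open import Data.List using ([]; _∷_; _++_; [_]; replicate)
  open import Data.Nat.Primality using (prime⇒nonTrivial)
  open import Algebra.Properties.Ring ring using (-‿involutive; -0#≈0#)
  open import Algebra.Properties.Group +-group using (x∙y⁻¹≈ε⇒x≈y; x≈y⇒x∙y⁻¹≈ε)
  open IntegerCoefficientSolver L-ring using (solve; _:+_; _:*_; _:-_; :-_; _:=_; con)
  open import Relation.Binary.Reasoning.Setoid setoid

  F : Carrier → Carrier
  F x = pow x q

  open TwistedOperators L-ring F (frobenius {e = e} p-prime q≡pᵉ char-p)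

  τ^-suc : ∀ k μ → τ^ (suc k) μ ≈ τ^ k (F μ)
  τ^-suc k μ = sym (pow-assocʳ μ q (q ^ k))

  τ^1≈F : ∀ μ → τ^ 1 μ ≈ F μ
  τ^1≈F μ = trans (τ^-suc 0 μ) (*-identityʳ _)

  τ^2≈F² : ∀ μ → τ^ 2 μ ≈ F (F μ)
  τ^2≈F² μ = trans (τ^-suc 1 μ) (τ^1≈F (F μ))

  τ^3≈F³ : ∀ μ → τ^ 3 μ ≈ F (F (F μ))
  τ^3≈F³ μ = trans (τ^-suc 2 μ) (τ^2≈F² (F μ))

  lam≈λ : ∀ u μ → lam u μ ≈ λ[ u ] μ
  lam≈λ u μ = +-congʳ (τ^1≈F μ)

  Φ_T≈Φ[G] : ∀ μ → Φ_T μ ≈ Φ[ G ] μ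
  Φ_T≈Φ[G] μ = +-congʳ (+-cong (-‿cong (τ^3≈F³ μ)) (*-congˡ (τ^2≈F² μ)))

  pow[q+1] : ∀ v → pow v (q +ℕ 1) ≈ F v * v
  pow[q+1] v = trans (pow-homo-* v q 1) (*-congˡ (*-identityʳ v))

  pow[q²+q] : ∀ v → pow v (q ^ 2 +ℕ q) ≈ F (F v) * F v
  pow[q²+q] v = trans (pow-homo-* v (q ^ 2) q) (*-congʳ (τ^2≈F² v))

  pow[q²+q+1] : ∀ v → pow v (q ^ 2 +ℕ q +ℕ 1) ≈ F (F v) * F v * v
  pow[q²+q+1] v = trans (pow-homo-* v (q ^ 2 +ℕ q) 1) (*-cong (pow[q²+q] v) (*-identityʳ v))

  x*y≈0⇒y≈0 : ∀ {x y} → ¬ (x ≈ 0#) → x * y ≈ 0# → y ≈ 0#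
  x*y≈0⇒y≈0 {x} {y} x≉0 xy≈0 = begin
    y                 ≈⟨ *-identityˡ y ⟨
    1# * y            ≈⟨ *-congʳ (inverseʳ x x≉0) ⟨
    (x * (x ⁻¹)) * y  ≈⟨ solve 3 (λ x x⁻¹ y → (x :* x⁻¹) :* y := (x :* y) :* x⁻¹) refl x (x ⁻¹) y ⟩
    (x * y) * (x ⁻¹)  ≈⟨ *-congʳ xy≈0 ⟩
    0# * (x ⁻¹)       ≈⟨ zeroˡ _ ⟩
    0#                ∎

  x≉0∧y≉0⇒x*y≉0 : ∀ {x y} → ¬ (x ≈ 0#) → ¬ (y ≈ 0#) → ¬ (x * y ≈ 0#)
  x≉0∧y≉0⇒x*y≉0 x≉0 y≉0 xy≈0 = y≉0 (x*y≈0⇒y≈0 x≉0 xy≈0)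

  x≉0⇒pow≉0 : ∀ {x} n → ¬ (x ≈ 0#) → ¬ (pow x n ≈ 0#)
  x≉0⇒pow≉0 zero x≉0 1≈0 = 0≉1 (sym 1≈0)
  x≉0⇒pow≉0 (suc n) x≉0 = x≉0∧y≉0⇒x*y≉0 x≉0 (x≉0⇒pow≉0 n x≉0)

  G⁺ : Carrier → Carrier
  G⁺ a = next-parameter a (pow a (q ^ 2 +ℕ q) ⁻¹)

  G⁺-intertwines : ∀ H a → ¬ (a ≈ 0#) → Φ-eigenvalue H a ≈ 0# → ∀ μ → λ[ a ] (Φ[ H ] μ) ≈ Φ[ G⁺ a ] (λ[ a ] μ)
  G⁺-intertwines H a a≉0 eigen≈0 = uncurry (λ-intertwines-Φ a H (G⁺ a)) (intertwining-conditions H a _ inverse eigen≈0)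
    where
    inverse : F (F a) * F a * pow a (q ^ 2 +ℕ q) ⁻¹ ≈ 1#
    inverse = trans (*-congʳ (sym (pow[q²+q] a))) (inverseʳ _ (x≉0⇒pow≉0 (q ^ 2 +ℕ q) a≉0))

  κ≈-Φ-eigenvalue : ∀ a v → κ a v ≈ - Φ-eigenvalue (G⁺ a) v
  κ≈-Φ-eigenvalue a v = begin
    pow v (q ^ 2 +ℕ q +ℕ 1) + K * pow v (q +ℕ 1) - 1#  ≈⟨ +-congʳ (+-cong (pow[q²+q+1] v) (*-cong K≈ (pow[q+1] v))) ⟩
    F (F v) * F v * v + - G⁺ a * (F v * v) - 1#
      ≈⟨ solve 4 (λ c b v g → c :* b :* v :+ (:- g) :* (b :* v) :- con (+ 1)
                         := :- (:- (c :* b :* v) :+ g :* (b :* v) :+ con (+ 1))) refl (F (F v)) (F v) v (G⁺ a) ⟩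
    - Φ-eigenvalue (G⁺ a) v                             ∎
    where
    K : Carrier
    K = (1# - pow a (q ^ 2 +ℕ q +ℕ 1)) / pow a (q ^ 2 +ℕ q)
    K≈ : K ≈ - G⁺ a
    K≈ = trans (*-congʳ (+-congˡ (-‿cong (pow[q²+q+1] a)))) (sym (-‿involutive _))

  κ≈0⇔Φ-eigenvalue≈0 : ∀ a v → κ a v ≈ 0# ⇔ Φ-eigenvalue (G⁺ a) v ≈ 0#
  κ≈0⇔Φ-eigenvalue≈0 a v = mk⇔
    (λ κ≈0 → trans (sym (-‿involutive _)) (trans (-‿cong (trans (sym (κ≈-Φ-eigenvalue a v)) κ≈0)) -0#≈0#))
    (λ eigen≈0 → trans (κ≈-Φ-eigenvalue a v) (trans (-‿cong eigen≈0) -0#≈0#))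

  ≈[a^[q²+q+1]-1]/a^[q+1]⇔Φ-eigenvalue≈0 : ∀ H a → ¬ (a ≈ 0#) →
    H ≈ (pow a (q ^ 2 +ℕ q +ℕ 1) - 1#) / pow a (q +ℕ 1) ⇔ Φ-eigenvalue H a ≈ 0#
  ≈[a^[q²+q+1]-1]/a^[q+1]⇔Φ-eigenvalue≈0 H a a≉0 = mk⇔ to from
    where
    M s i : Carrier
    M = pow a (q ^ 2 +ℕ q +ℕ 1)
    s = pow a (q +ℕ 1)
    i = s ⁻¹
    s*i≈1 : s * i ≈ 1#
    s*i≈1 = inverseʳ s (x≉0⇒pow≉0 (q +ℕ 1) a≉0)
    eigen≈ : Φ-eigenvalue H a ≈ - M + H * s + 1#
    eigen≈ = +-congʳ (+-cong (-‿cong (sym (pow[q²+q+1] a))) (*-congˡ (sym (pow[q+1] a))))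
    to : H ≈ (M - 1#) * i → Φ-eigenvalue H a ≈ 0#
    to H≈ = begin
      Φ-eigenvalue H a              ≈⟨ eigen≈ ⟩
      - M + H * s + 1#              ≈⟨ +-congʳ (+-congˡ (*-congʳ H≈)) ⟩
      - M + (M - 1#) * i * s + 1#   ≈⟨ solve 3 (λ M s i → :- M :+ (M :- con (+ 1)) :* i :* s :+ con (+ 1)
                                                   := :- M :+ (M :- con (+ 1)) :* (s :* i) :+ con (+ 1)) refl M s i ⟩
      - M + (M - 1#) * (s * i) + 1# ≈⟨ +-congʳ (+-congˡ (*-congˡ s*i≈1)) ⟩
      - M + (M - 1#) * 1# + 1#      ≈⟨ solve 1 (λ M → :- M :+ (M :- con (+ 1)) :* con (+ 1) :+ con (+ 1) := con (+ 0)) refl M ⟩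
      0#                            ∎
    from : Φ-eigenvalue H a ≈ 0# → H ≈ (M - 1#) * i
    from eigen≈0 = begin
      H                                   ≈⟨ *-identityʳ H ⟨
      H * 1#                              ≈⟨ *-congˡ s*i≈1 ⟨
      H * (s * i)                         ≈⟨ solve 4 (λ H M s i → H :* (s :* i)
                                                := ((:- M :+ H :* s :+ con (+ 1)) :+ (M :- con (+ 1))) :* i) refl H M s i ⟩
      ((- M + H * s + 1#) + (M - 1#)) * i ≈⟨ *-congʳ (+-congʳ (trans (sym eigen≈) eigen≈0)) ⟩
      (0# + (M - 1#)) * i                 ≈⟨ *-congʳ (+-identityˡ _) ⟩
      (M - 1#) * i                        ∎

  2≤q : 2 ≤ q
  2≤q = ≡.subst (2 ≤_) (≡.sym q≡pᵉ)
          (ℕₚ.^-monoʳ-< p (ℕ.nonTrivial⇒n>1 p {{prime⇒nonTrivial p-prime}}) {0} {e} 1≤e)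

  F≈x*x*pow[q∸2] : ∀ x → F x ≈ x * (x * pow x (q ℕ.∸ 2))
  F≈x*x*pow[q∸2] x = pow-congʳ x (≡.sym (ℕₚ.m+[n∸m]≡n 2≤q))

  evalPoly-monomial : ∀ k x → evalPoly (replicate k 0# ++ [ 1# ]) x ≈ pow x k
  evalPoly-monomial zero x = trans (+-congˡ (zeroʳ x)) (+-identityʳ _)
  evalPoly-monomial (suc k) x = trans (+-identityˡ _) (*-congˡ (evalPoly-monomial k x))

  -- A root of X^(q-1) - a.
  F-eigenvector : ∀ a → ¬ (a ≈ 0#) → ∃ λ w → ¬ (w ≈ 0#) × F w ≈ a * w
  F-eigenvector a a≉0 with algClosed ((- a) ∷ replicate (q ℕ.∸ 2) 0#) (λ ())
  ... | w , root = w , w≉0 , Fw≈aw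
    where
    W : Carrier
    W = w * pow w (q ℕ.∸ 2)
    W≈a : W ≈ a
    W≈a = x∙y⁻¹≈ε⇒x≈y W a (trans (+-comm _ _) (trans (+-congˡ (*-congˡ (sym (evalPoly-monomial (q ℕ.∸ 2) w)))) root))
    w≉0 : ¬ (w ≈ 0#)
    w≉0 w≈0 = a≉0 (trans (sym W≈a) (trans (*-congʳ w≈0) (zeroˡ _)))
    Fw≈aw : F w ≈ a * w
    Fw≈aw = trans (F≈x*x*pow[q∸2] w) (trans (*-congˡ W≈a) (*-comm w a))

  -- A root of X^q - a X - y.
  λ-surjective : ∀ a y → ∃ λ x → λ[ a ] x ≈ y
  λ-surjective a y with algClosed ((- y) ∷ (- a) ∷ replicate (q ℕ.∸ 2) 0#) (λ ())
  ... | x , root = x , (begin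
      F x - a * x                        ≈⟨ +-congʳ (trans (F≈x*x*pow[q∸2] x) (*-congˡ (*-congˡ (sym (evalPoly-monomial (q ℕ.∸ 2) x))))) ⟩
      x * (x * E) - a * x                ≈⟨ solve 4 (λ x E a y → x :* (x :* E) :- a :* x := (:- y :+ x :* (:- a :+ x :* E)) :+ y) refl x E a y ⟩
      (- y + x * (- a + x * E)) + y      ≈⟨ +-congʳ root ⟩
      0# + y                             ≈⟨ +-identityˡ y ⟩
      y                                  ∎)
    where
    E : Carrier
    E = evalPoly (replicate (q ℕ.∸ 2) 0# ++ [ 1# ]) x

  lams-surjective : ∀ (u : ℕ → Carrier) k y → ∃ λ μ → lams u k μ ≈ y
  lams-surjective u zero y = y , refl
  lams-surjective u (suc k) y with λ-surjective (u (suc k)) y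
  ... | z , λz≈y with lams-surjective u k z
  ...   | μ , μ↦z = μ , trans (lam≈λ _ _) (trans (λ-congʳ _ μ↦z) λz≈y)

  module _ (u : ℕ → Carrier) where

    Gₖ : ℕ → Carrier
    Gₖ zero = G
    Gₖ (suc k) = G⁺ (u (suc k))

    NonZeroBelow : ℕ → Set ℓ
    NonZeroBelow n = ∀ j → j < n → ¬ (u (suc j) ≈ 0#)

    Admissible : ℕ → Set ℓ
    Admissible n = ∀ j → j < n → Φ-eigenvalue (Gₖ j) (u (suc j)) ≈ 0#

    TorsionStep : ℕ → Set (c Level.⊔ ℓ)
    TorsionStep k = ∀ μ → V u (suc k) μ → V u k (Φ_T μ)

    restrict : ∀ {P : ℕ → Set ℓ} {m n} → m ≤ n → (∀ j → j < n → P j) → ∀ j → j < m → P j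
    restrict m≤n below-n j j<m = below-n j (ℕₚ.≤-trans j<m m≤n)

    lams-intertwines-Φ : ∀ k → NonZeroBelow k → Admissible k → ∀ μ → lams u k (Φ_T μ) ≈ Φ[ Gₖ k ] (lams u k μ)
    lams-intertwines-Φ zero _ _ μ = Φ_T≈Φ[G] μ
    lams-intertwines-Φ (suc k) nz adm μ = begin
      lam a (lams u k (Φ_T μ))   ≈⟨ lam≈λ a _ ⟩
      λ[ a ] (lams u k (Φ_T μ))  ≈⟨ λ-congʳ a (lams-intertwines-Φ k (restrict (ℕₚ.n≤1+n k) nz) (restrict (ℕₚ.n≤1+n k) adm) μ) ⟩
      λ[ a ] (Φ[ Gₖ k ] X)       ≈⟨ G⁺-intertwines (Gₖ k) a (nz k ℕₚ.≤-refl) (adm k ℕₚ.≤-refl) X ⟩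
      Φ[ G⁺ a ] (λ[ a ] X)       ≈⟨ Φ-congʳ (G⁺ a) (lam≈λ a X) ⟨
      Φ[ G⁺ a ] (lam a X)        ∎
      where
      a X : Carrier
      a = u (suc k)
      X = lams u k μ

    V[k+1]⇒F-eigenvector : ∀ k μ → V u (suc k) μ → F (lams u k μ) ≈ u (suc k) * lams u k μ
    V[k+1]⇒F-eigenvector k μ μ∈V = x∙y⁻¹≈ε⇒x≈y _ _ (trans (sym (lam≈λ _ _)) μ∈V)

    admissible⇒torsionStep : ∀ k → NonZeroBelow (suc k) → Admissible (suc k) → TorsionStep k
    admissible⇒torsionStep k nz adm μ μ∈V = begin
      lams u k (Φ_T μ)                        ≈⟨ lams-intertwines-Φ k (restrict (ℕₚ.n≤1+n k) nz) (restrict (ℕₚ.n≤1+n k) adm) μ ⟩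
      Φ[ Gₖ k ] X                             ≈⟨ Φ-eigenvector (Gₖ k) (u (suc k)) X (V[k+1]⇒F-eigenvector k μ μ∈V) ⟩
      X * Φ-eigenvalue (Gₖ k) (u (suc k))     ≈⟨ *-congˡ (adm k ℕₚ.≤-refl) ⟩
      X * 0#                                  ≈⟨ zeroʳ X ⟩
      0#                                      ∎
      where
      X : Carrier
      X = lams u k μ

    -- Test the torsion step on a preimage under λ^(u_k)⋯λ^(u_1) of a nonzero F-eigenvector w
    -- with eigenvalue u_{k+1}: it forces w · Φ-eigenvalue = 0.
    torsionStep⇒eigenvalue≈0 : ∀ k → NonZeroBelow (suc k) → Admissible k → TorsionStep k →
                               Φ-eigenvalue (Gₖ k) (u (suc k)) ≈ 0#
    torsionStep⇒eigenvalue≈0 k nz adm step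
      with F-eigenvector (u (suc k)) (nz k ℕₚ.≤-refl)
    ... | w , w≉0 , Fw≈aw with lams-surjective u k w
    ...   | μ , μ↦w = x*y≈0⇒y≈0 w≉0 (begin
      w * Φ-eigenvalue (Gₖ k) (u (suc k))     ≈⟨ Φ-eigenvector (Gₖ k) (u (suc k)) w Fw≈aw ⟨
      Φ[ Gₖ k ] w                             ≈⟨ Φ-congʳ (Gₖ k) μ↦w ⟨
      Φ[ Gₖ k ] (lams u k μ)                  ≈⟨ lams-intertwines-Φ k (restrict (ℕₚ.n≤1+n k) nz) adm μ ⟨
      lams u k (Φ_T μ)                        ≈⟨ step μ μ∈V ⟩
      0#                                      ∎)
      where
      μ∈V : V u (suc k) μ
      μ∈V = trans (lam≈λ _ _) (trans (λ-congʳ _ μ↦w) (x≈y⇒x∙y⁻¹≈ε Fw≈aw))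

    torsionSteps⇔admissible : ∀ n → NonZeroBelow n → (∀ k → k < n → TorsionStep k) ⇔ Admissible n
    torsionSteps⇔admissible n nz = mk⇔ (λ steps → admissibleUpTo steps n ℕₚ.≤-refl)
      (λ adm k k<n → admissible⇒torsionStep k (restrict k<n nz) (restrict k<n adm))
      where
      admissibleUpTo : (∀ k → k < n → TorsionStep k) → ∀ m → m ≤ n → Admissible m
      admissibleUpTo steps zero _ j ()
      admissibleUpTo steps (suc m) m<n j j<1+m with ℕₚ.m<1+n⇒m<n∨m≡n j<1+m
      ... | inj₁ j<m = admissibleUpTo steps m (ℕₚ.<⇒≤ m<n) j j<m
      ... | inj₂ ≡.refl = torsionStep⇒eigenvalue≈0 j (restrict m<n nz) (admissibleUpTo steps j (ℕₚ.<⇒≤ m<n)) (steps j m<n)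

    torsionFlag⇔torsionSteps : ∀ n → 1 ≤ n → IsΦTorsionFlag n u ⇔ (∀ k → k < n → TorsionStep k)
    torsionFlag⇔torsionSteps n 1≤n = mk⇔
      (λ { (first , rest) zero _ → first ; (first , rest) (suc k) k<n → rest (suc (suc k)) (s≤s (s≤s z≤n)) k<n })
      (λ steps → steps 0 1≤n , λ { (suc k) _ k<n → steps k k<n })

    admissible⇔conditions : ∀ n → 1 ≤ n → NonZeroBelow n →
      Admissible n ⇔ ((G ≈ (pow (u 1) (q ^ 2 +ℕ q +ℕ 1) - 1#) / pow (u 1) (q +ℕ 1))
                     × (∀ i → 1 ≤ i → i < n → κ (u i) (u (suc i)) ≈ 0#))
    admissible⇔conditions n 1≤n nz = mk⇔
      (λ adm → Equivalence.from (G-condition) (adm 0 1≤n)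
             , λ { (suc i) _ i<n → Equivalence.from (κ≈0⇔Φ-eigenvalue≈0 (u (suc i)) (u (suc (suc i)))) (adm (suc i) i<n) })
      (λ { (G≈ , κ≈0) zero _ → Equivalence.to G-condition G≈
         ; (G≈ , κ≈0) (suc j) j<n → Equivalence.to (κ≈0⇔Φ-eigenvalue≈0 (u (suc j)) (u (suc (suc j)))) (κ≈0 (suc j) (s≤s z≤n) j<n) })
      where
      G-condition : G ≈ (pow (u 1) (q ^ 2 +ℕ q +ℕ 1) - 1#) / pow (u 1) (q +ℕ 1) ⇔ Φ-eigenvalue G (u 1) ≈ 0#
      G-condition = ≈[a^[q²+q+1]-1]/a^[q+1]⇔Φ-eigenvalue≈0 G (u 1) (nz 0 1≤n)

theorem6p2 : ∀ {c ℓ : Level} {q : ℕ} → (L : AlgClosureFqG c ℓ q) →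
    let open Ops L in
    (n : ℕ) → 2 ≤ n → (u : ℕ → Carrier) → (∀ i → 1 ≤ i → i ≤ n → ¬ (u i ≈ 0#)) →
    IsΦTorsionFlag n u
    ⇔ ((G ≈ ((pow (u 1) (q ^ 2 +ℕ q +ℕ 1) - 1#) / pow (u 1) (q +ℕ 1)))
    × (∀ i → 1 ≤ i → i < n → κ (u i) (u (suc i)) ≈ 0#))
theorem6p2 L n 2≤n u u≉0 =
  admissible⇔conditions u n 1≤n nonZero
    ⇔-∘ (torsionSteps⇔admissible u n nonZero ⇔-∘ torsionFlag⇔torsionSteps u n 1≤n)
  where
  open TorsionFlags L
  1≤n : 1 ≤ n
  1≤n = ℕₚ.≤-trans (s≤s z≤n) 2≤n
  nonZero : NonZeroBelow u n
  nonZero j j<n = u≉0 (suc j) (s≤s z≤n) j<n
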